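{- Let $T$ be a strong monad and $R$ a $T$-algebra, and let $J^T_R X = (X \to R) \to TX$. Then $J^T_R$ is a strong monad with the operations \[ \eta^{J^T_R}_X(x) = \lambda p . \eta^T_X(x), \] and, for $\delta \colon X \to J^T_R Y$, the map $\delta^\dagger \colon J^T_R X \to J^T_R Y$ given by \[ \delta^\dagger(\varepsilon) = \lambda p^{Y \to R} . (b_p)^\dagger\big(\varepsilon(p^* \circ b_p)\big), \qquad \text{where } b_p \colon X \to TY,\ b_p(x) = \delta(x)(p). \] That is, these operations satisfy (i) $(\eta^{J^T_R}_X)^\dagger = \mathrm{id}$, (ii) $g^\dagger \circ \eta^{J^T_R}_Y = g$, (iii) $(g^\dagger \circ f)^\dagger = g^\dagger \circ f^\dagger$ for all $f \colon X \to J^T_R Y$, $g \colon Y \to J^T_R Z$.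
   Context: We work in Gödel's System T with full extensionality. A type operator $T$ is a strong monad if there are families of closed terms $\eta_X \colon X \to TX$ and $(\cdot)^\dagger \colon (X \to TY) \to (TX \to TY)$ such that, provably, (i) $(\eta_X)^\dagger = \mathrm{id}_{TX}$, (ii) $g^\dagger \circ \eta_Y = g$, (iii) $(g^\dagger \circ f)^\dagger = g^\dagger \circ f^\dagger$, for all $f \colon X \to TY$, $g \colon Y \to TZ$. A type $R$ is a $T$-algebra if there is a family of maps $(\cdot)^* \colon (X \to R) \to (TX \to R)$ such that (i) $g^* \circ \eta_Y = g$ and (ii) $(g^* \circ f)^* = g^* \circ f^\dagger$ for all $g \colon Y \to R$, $f \colon X \to TY$. Elements of $J^T_R X$ are called $T$-selection functions. -}

module Defs where

open import Function using (id; _∘_)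
open import Relation.Binary.PropositionalEquality using (_≡_)

record IsStrongMonad (T : Set → Set)
                     (η : ∀ {X : Set} → X → T X)
                     (_† : ∀ {X Y : Set} → (X → T Y) → T X → T Y) : Set₁ where
  field
    law-i   : ∀ {X : Set} → (η {X}) † ≡ id
    law-ii  : ∀ {Y Z : Set} (g : Y → T Z) → (g †) ∘ η ≡ g
    law-iii : ∀ {X Y Z : Set} (f : X → T Y) (g : Y → T Z) →
              ((g †) ∘ f) † ≡ (g †) ∘ (f †)

record IsTAlgebra (T : Set → Set)
                  (η : ∀ {X : Set} → X → T X)
                  (_† : ∀ {X Y : Set} → (X → T Y) → T X → T Y)
                  (R : Set)
                  (_* : ∀ {X : Set} → (X → R) → T X → R) : Set₁ where
  field
    alg-i  : ∀ {Y : Set} (g : Y → R) → (g *) ∘ η ≡ g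
    alg-ii : ∀ {X Y : Set} (g : Y → R) (f : X → T Y) →
             ((g *) ∘ f) * ≡ (g *) ∘ (f †)

J : (T : Set → Set) (R : Set) → Set → Set
J T R X = (X → R) → T X

ηJ : {T : Set → Set} {R : Set} (η : ∀ {X : Set} → X → T X) →
     ∀ {X : Set} → X → J T R X
ηJ η x = λ p → η x

bindJ : {T : Set → Set} {R : Set}
        (_† : ∀ {X Y : Set} → (X → T Y) → T X → T Y)
        (_* : ∀ {X : Set} → (X → R) → T X → R) →
        ∀ {X Y : Set} → (X → J T R Y) → J T R X → J T R Y
bindJ _† _* δ ε = λ p → let b = λ x → δ x p in (b †) (ε ((p *) ∘ b))

module Submission where

-- The unit
-- of J^T_R is η^J x = λ p. η x, and δ^† ε = λ p. (b_p)† (ε (p* ∘ b_p)) with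
-- b_p x = δ x p.  Each monad law for J^T_R is checked pointwise, at a fixed
-- selection function ε and a fixed predicate p : Y → R, and then lifted to
-- an equation of functions by extensionality:
--   (i)   reduces to law (i) of T together with algebra law p* ∘ η = p;
--   (ii)  holds by law (ii) of T applied to b_p;
--   (iii) is the interesting one: the predicate passed to ε on the left-hand
--         side is p* ∘ (c†) ∘ a, where c = λ y. g y p, and algebra law (ii)
--         rewrites it to (p* ∘ c)* ∘ a, the predicate used on the right-hand
--         side; after that, law (iii) of T finishes the proof.

open import Defs
open import Level using (0ℓ)
open import Axiom.Extensionality.Propositional using (Extensionality)
open import Relation.Binary.PropositionalEquality
  using (_≡_; sym; cong; cong-app; module ≡-Reasoning)
open import Function using (_∘_)

module SelectionMonad
  (ext  : Extensionality 0ℓ 0ℓ)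
  (T    : Set → Set)
  (η    : ∀ {X : Set} → X → T X)
  (_†   : ∀ {X Y : Set} → (X → T Y) → T X → T Y)
  (isMonad : IsStrongMonad T η _†)
  (R    : Set)
  (_*   : ∀ {X : Set} → (X → R) → T X → R)
  (isAlgebra : IsTAlgebra T η _† R _*)
  where

  open IsStrongMonad isMonad
  open IsTAlgebra isAlgebra

  ηᴶ : ∀ {X : Set} → X → J T R X
  ηᴶ = ηJ {T} {R} η

  _†ᴶ : ∀ {X Y : Set} → (X → J T R Y) → J T R X → J T R Y
  _†ᴶ = bindJ {T} {R} _† _*

  unit-extension : ∀ {X : Set} (ε : J T R X) (p : X → R) → (ηᴶ †ᴶ) ε p ≡ ε p
  unit-extension ε p = begin
    (η †) (ε ((p *) ∘ η))  ≡⟨ cong-app law-i (ε ((p *) ∘ η)) ⟩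
    ε ((p *) ∘ η)          ≡⟨ cong ε (alg-i p) ⟩
    ε p                    ∎
    where open ≡-Reasoning

  extension-unit : ∀ {Y Z : Set} (g : Y → J T R Z) (y : Y) (p : Z → R) →
                   (g †ᴶ) (ηᴶ y) p ≡ g y p
  extension-unit g y p = cong-app (law-ii (λ y′ → g y′ p)) y

  test-after-extension : ∀ {X Y Z : Set} (p : Z → R) (c : Y → T Z) (a : X → T Y) →
                         (p *) ∘ (c †) ∘ a ≡ ((p *) ∘ c) * ∘ a
  test-after-extension p c a = cong (_∘ a) (sym (alg-ii p c))

  -- With c = λ y. g y p, the composite g†ᴶ ∘ f
  -- has b_p = c† ∘ a for a = λ x. f x (p* ∘ c), so both sides are Kleisli
  -- composites in T once the predicates handed to ε agree.
  extension-composition :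
    ∀ {X Y Z : Set} (f : X → J T R Y) (g : Y → J T R Z) (ε : J T R X) (p : Z → R) →
    (((g †ᴶ) ∘ f) †ᴶ) ε p ≡ (g †ᴶ) ((f †ᴶ) ε) p
  extension-composition {X} {Y} {Z} f g ε p = begin
    (((c †) ∘ a) †) (ε ((p *) ∘ (c †) ∘ a))  ≡⟨ cong (((c †) ∘ a) †)
                                                    (cong ε (test-after-extension p c a)) ⟩
    (((c †) ∘ a) †) (ε (((p *) ∘ c) * ∘ a))  ≡⟨ cong-app (law-iii a c) (ε (((p *) ∘ c) * ∘ a)) ⟩
    (c †) ((a †) (ε (((p *) ∘ c) * ∘ a)))    ∎
    where
      open ≡-Reasoning
      c : Y → T Z
      c y = g y p
      a : X → T Y
      a x = f x ((p *) ∘ c)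

  isStrongMonad : IsStrongMonad (J T R) ηᴶ _†ᴶ
  isStrongMonad = record
    { law-i   = ext λ ε → ext (unit-extension ε)
    ; law-ii  = λ g → ext λ y → ext (extension-unit g y)
    ; law-iii = λ f g → ext λ ε → ext (extension-composition f g ε)
    }

lemma2p2 : Extensionality 0ℓ 0ℓ →
    (T : Set → Set) (η : ∀ {X : Set} → X → T X)
    (bind : ∀ {X Y : Set} → (X → T Y) → T X → T Y) →
    IsStrongMonad T η bind →
    (R : Set) (star : ∀ {X : Set} → (X → R) → T X → R) →
    IsTAlgebra T η bind R star →
    IsStrongMonad (J T R) (λ {X} → ηJ {T} {R} η {X}) (λ {X} {Y} → bindJ {T} {R} bind star {X} {Y})
lemma2p2 ext T η bind isMonad R star isAlgebra =
  SelectionMonad.isStrongMonad ext T η bind isMonad R star isAlgebra
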